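{- A signed digraph $(D,\sigma)$ is cycle balanced if and only if every strong component of $D$, regarded as an undirected signed graph (ignoring directions), is balanced; i.e., its vertex set has a bipartition $\{X,Y\}$ (one part possibly empty) such that every positive edge has both endpoints in $X$ or both in $Y$, and every negative edge has one endpoint in $X$ and one in $Y$.
   Context: A signed digraph $(D,\sigma)$ is a directed graph $D$ with a map $\sigma:E(D)\to\{+,-\}$. A cycle is a connected subgraph in which every vertex has in-degree and out-degree $1$; its sign is the product of its edge signs. $(D,\sigma)$ is cycle balanced if every cycle is positive. Strong components are the maximal strongly connected subgraphs. An undirected signed graph is balanced if every circle (connected 2-regular subgraph) has positive sign. -}

module Defs where

open import Data.Nat using (ℕ; zero; suc; _+_)
open import Data.Fin using (Fin; _≟_)
open import Relation.Nullary.Decidable using (⌊_⌋)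
open import Data.Bool using (Bool; true; false; if_then_else_; _∧_)
open import Data.List using (List; foldr; map; allFin)
open import Data.Nat.ListAction using (sum)
open import Data.Product using (Σ; ∃; _×_; _,_)
open import Data.Sum using (_⊎_)
open import Relation.Binary.PropositionalEquality using (_≡_; _≢_)

data Sign : Set where
  plus minus : Sign

_·_ : Sign → Sign → Sign
plus  · s = s
minus · plus = minus
minus · minus = plus

-- A finite signed digraph: vertices Fin n, arcs Fin m (loops and
-- parallel arcs allowed), each arc e goes from tail e to head e.
record SignedDigraph : Set where
  field
    n    : ℕ
    m    : ℕ
    tail : Fin m → Fin n
    head : Fin m → Fin n
    sign : Fin m → Sign

module _ (D : SignedDigraph) where
  open SignedDigraph D

  -- A subgraph is given by its arc set S; its vertices are the
  -- endpoints of its arcs.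
  ArcSet : Set
  ArcSet = Fin m → Bool

  count : (Fin m → Bool) → ℕ
  count f = sum (map (λ e → if f e then 1 else 0) (allFin m))

  indeg : ArcSet → Fin n → ℕ
  indeg S v = count (λ e → S e ∧ ⌊ head e ≟ v ⌋)

  outdeg : ArcSet → Fin n → ℕ
  outdeg S v = count (λ e → S e ∧ ⌊ tail e ≟ v ⌋)

  InSub : ArcSet → Fin n → Set
  InSub S v = ∃ λ e → S e ≡ true × (tail e ≡ v ⊎ head e ≡ v)

  data UConn (S : ArcSet) : Fin n → Fin n → Set where
    here : ∀ {u} → UConn S u u
    fwd  : ∀ {v} e → S e ≡ true → UConn S (head e) v → UConn S (tail e) v
    bwd  : ∀ {v} e → S e ≡ true → UConn S (tail e) v → UConn S (head e) v

  IsCycle : ArcSet → Set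
  IsCycle S =
    (∃ λ e → S e ≡ true) ×
    (∀ v → InSub S v → indeg S v ≡ 1 × outdeg S v ≡ 1) ×
    (∀ u v → InSub S u → InSub S v → UConn S u v)

  sgn : ArcSet → Sign
  sgn S = foldr (λ e acc → if S e then sign e · acc else acc) plus (allFin m)

  CycleBalanced : Set
  CycleBalanced = ∀ S → IsCycle S → sgn S ≡ plus

  data Reach : Fin n → Fin n → Set where
    here : ∀ {u} → Reach u u
    step : ∀ {v} e → Reach (head e) v → Reach (tail e) v

  SameComp : Fin n → Fin n → Set
  SameComp u v = Reach u v × Reach v u

  -- The strong component C(r) = {v | SameComp r v} (with all arcs of D
  -- between its vertices), viewed as an undirected signed graph, is
  -- balanced: there is a bipartition {X,Y} of its vertices, given by
  -- X = {v ∈ C(r) | inX v ≡ true}, Y = {v ∈ C(r) | inX v ≡ false},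
  -- such that positive arcs stay within a part and negative arcs
  -- cross between the parts.
  ComponentBalanced : Fin n → Set
  ComponentBalanced r =
    Σ (Fin n → Bool) λ inX →
      ∀ e → SameComp r (tail e) → SameComp r (head e) →
        (sign e ≡ plus → inX (tail e) ≡ inX (head e)) ×
        (sign e ≡ minus → inX (tail e) ≢ inX (head e))

-- Record signs additively: a walk is negative when it has an odd number of negative arcs.
-- (⇒) A closed walk splits into simple closed walks, i.e. cycles, so under cycle balance every
-- closed walk is positive. Hence within the strong component of r all walks from r to x that
-- can be closed up have the same sign, and X = {x | some walk r → x is negative} is the required
-- bipartition; it is decidable because cutting closed subwalks out of a walk, which keeps its
-- sign, leaves one with fewer than n arcs.
-- (⇐) A cycle is strongly connected, so it lies inside one component, with bipartition x. Its
-- sign is the sum over its arcs of x (tail) + x (head), in which each vertex occurs twice.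
module Submission where

open import Algebra.Bundles using (CommutativeRing)
import Algebra.Properties.Semiring.Sum as SemiringSum
open import Data.Bool using (Bool; true; false; _∧_; _xor_; if_then_else_)
open import Data.Bool.Properties as Bool
  using ( xor-∧-commutativeRing; xor-identityʳ; xor-same; xor-assoc; xor-inverseˡ
        ; ∧-identityʳ; ∧-distribˡ-xor; not-involutive; ¬-not)
open import Data.Fin using (Fin; zero; suc; toℕ; _≟_)
open import Data.Fin.Properties using (any?; pigeonhole; suc-injective; 0≢1+n)
open import Data.List using (List; []; _∷_; _++_; _∷ʳ_; map; foldr; length; lookup; tabulate)
open import Data.List.Membership.Propositional using (_∈_)
import Data.List.Membership.DecPropositional as DecMembership
open import Data.List.Membership.Propositional.Properties
  using (∈-map⁺; ∈-map⁻; ∈-++⁺ˡ; ∈-++⁺ʳ; ∈-++⁻; ∈-lookup)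
open import Data.List.Relation.Unary.Any using (here; there)
open import Data.List.Relation.Unary.All as All using (All; []; _∷_)
open import Data.List.Relation.Unary.All.Properties using (¬Any⇒All¬; All¬⇒¬Any; ++⁻ˡ; ++⁻ʳ)
open import Data.List.Relation.Unary.Unique.Propositional using (Unique; []; _∷_)
import Data.List.Relation.Unary.Unique.Propositional.Properties as Unique
open import Data.List.Relation.Binary.Disjoint.Propositional using (Disjoint)
open import Data.Nat using (ℕ; zero; suc; pred; _+_; _≤_; _≤?_; z≤n; s≤s)
open import Data.Nat.ListAction using (sum)
open import Data.Nat.Properties using (≤-refl; <⇒≤; <-irrefl; ≰⇒>; m≤n⇒∃[o]m+o≡n; +-suc)
open import Data.Product using (Σ; ∃; _×_; _,_; proj₁; proj₂)
open import Data.Sum using (_⊎_; inj₁; inj₂)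
open import Function using (_∘_; id)
open import Function.Bundles using (_⇔_; mk⇔; Equivalence)
open import Relation.Nullary using (Dec; yes; no; contradiction)
open import Relation.Nullary.Decidable using (⌊_⌋; _×-dec_; _⊎-dec_)
open import Relation.Binary.PropositionalEquality

open import Defs

_∈?_ : ∀ {k} (x : Fin k) xs → Dec (x ∈ xs)
_∈?_ = DecMembership._∈?_ _≟_

module ⊕ = SemiringSum (CommutativeRing.semiring xor-∧-commutativeRing)

⨁ : ∀ {k} → (Fin k → Bool) → Bool
⨁ = ⊕.sum

⨁-zero : ∀ {k} (f : Fin k → Bool) → (∀ i → f i ≡ false) → ⨁ f ≡ false
⨁-zero {k} f f≗false = trans (⊕.sum-cong-≗ f≗false) (⊕.sum-replicate-zero k)

⨁-concentrated : ∀ {k} (f : Fin k → Bool) a → (∀ i → f i ≡ true → i ≡ a) → ⨁ f ≡ f a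
⨁-concentrated {suc k} f zero off =
  trans (cong (f zero xor_) (⨁-zero (f ∘ suc) λ i → ¬-not λ t → 0≢1+n (sym (off (suc i) t))))
        (xor-identityʳ (f zero))
⨁-concentrated {suc k} f (suc a) off with f zero in f0
... | true  = contradiction (off zero f0) λ ()
... | false = ⨁-concentrated (f ∘ suc) a λ i t → suc-injective (off (suc i) t)

∧-true⁻ : ∀ a {b} → a ∧ b ≡ true → a ≡ true × b ≡ true
∧-true⁻ true b≡true = refl , b≡true

⌊⌋-witness : ∀ {p} {P : Set p} (P? : Dec P) → ⌊ P? ⌋ ≡ true → P
⌊⌋-witness (yes p) _ = p

⌊yes⌋ : ∀ {p} {P : Set p} (P? : Dec P) → P → ⌊ P? ⌋ ≡ true
⌊yes⌋ (yes _) _ = refl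
⌊yes⌋ (no ¬p) p = contradiction p ¬p

⨁-fibres : ∀ {k l} (τ : Fin k → Fin l) (w : Fin k → Bool) (x : Fin l → Bool) →
  ⨁ (λ f → w f ∧ x (τ f)) ≡ ⨁ (λ v → ⨁ (λ f → w f ∧ ⌊ τ f ≟ v ⌋) ∧ x v)
⨁-fibres {k} {l} τ w x = begin
  ⨁ (λ f → w f ∧ x (τ f))                         ≡⟨ ⊕.sum-cong-≗ (λ f → sym (fibre f)) ⟩
  ⨁ (λ f → ⨁ (λ v → δ v f ∧ x v))                 ≡⟨ ⊕.∑-comm {k} {l} (λ f v → δ v f ∧ x v) ⟩
  ⨁ (λ v → ⨁ (λ f → δ v f ∧ x v))                 ≡⟨ ⊕.sum-cong-≗ (λ v → sym (⊕.*-distribʳ-sum (x v) (δ v))) ⟩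
  ⨁ (λ v → ⨁ (λ f → w f ∧ ⌊ τ f ≟ v ⌋) ∧ x v)     ∎
  where
  open ≡-Reasoning
  δ : Fin l → Fin k → Bool
  δ v f = w f ∧ ⌊ τ f ≟ v ⌋
  fibre : ∀ f → ⨁ (λ v → δ v f ∧ x v) ≡ w f ∧ x (τ f)
  fibre f = begin
    ⨁ (λ v → δ v f ∧ x v)
      ≡⟨ ⨁-concentrated (λ v → δ v f ∧ x v) (τ f) (λ v t →
           sym (⌊⌋-witness (τ f ≟ v) (proj₂ (∧-true⁻ (w f) (proj₁ (∧-true⁻ (δ v f) t)))))) ⟩
    (w f ∧ ⌊ τ f ≟ τ f ⌋) ∧ x (τ f)
      ≡⟨ cong (λ b → (w f ∧ b) ∧ x (τ f)) (⌊yes⌋ (τ f ≟ τ f) refl) ⟩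
    (w f ∧ true) ∧ x (τ f)
      ≡⟨ cong (_∧ x (τ f)) (∧-identityʳ (w f)) ⟩
    w f ∧ x (τ f) ∎

countTrue : ∀ {k} → (Fin k → Bool) → ℕ
countTrue {zero}  f = 0
countTrue {suc k} f = (if f zero then 1 else 0) + countTrue (f ∘ suc)

countTrue-zero : ∀ {k} (f : Fin k → Bool) → (∀ i → f i ≡ false) → countTrue f ≡ 0
countTrue-zero {zero}  f f≗false = refl
countTrue-zero {suc k} f f≗false rewrite f≗false zero = countTrue-zero (f ∘ suc) (f≗false ∘ suc)

countTrue≡0⇒false : ∀ {k} (f : Fin k → Bool) → countTrue f ≡ 0 → ∀ i → f i ≡ false
countTrue≡0⇒false {suc k} f c i with f zero in f0
countTrue≡0⇒false {suc k} f c zero    | false = f0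
countTrue≡0⇒false {suc k} f c (suc i) | false = countTrue≡0⇒false (f ∘ suc) c i

countTrue-singleton : ∀ {k} (f : Fin k → Bool) a → f a ≡ true → (∀ i → f i ≡ true → i ≡ a) →
  countTrue f ≡ 1
countTrue-singleton {suc k} f zero fa off rewrite fa =
  cong suc (countTrue-zero (f ∘ suc) λ i → ¬-not λ t → 0≢1+n (sym (off (suc i) t)))
countTrue-singleton {suc k} f (suc a) fa off with f zero in f0
... | true  = contradiction (off zero f0) λ ()
... | false = countTrue-singleton (f ∘ suc) a fa λ i t → suc-injective (off (suc i) t)

countTrue≡1⇒singleton : ∀ {k} (f : Fin k → Bool) → countTrue f ≡ 1 →
  ∃ λ a → f a ≡ true × ∀ i → f i ≡ true → i ≡ a
countTrue≡1⇒singleton {suc k} f c with f zero in f0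
... | true  = zero , f0 , λ { zero _ → refl
                            ; (suc i) t → contradiction
                                (trans (sym (countTrue≡0⇒false (f ∘ suc) (cong pred c) i)) t) λ () }
... | false with countTrue≡1⇒singleton (f ∘ suc) c
...   | a , fa , off = suc a , fa , λ { zero t → contradiction (trans (sym f0) t) λ ()
                                      ; (suc i) t → cong suc (off i t) }

countTrue≡1⇒⨁ : ∀ {k} (f : Fin k → Bool) → countTrue f ≡ 1 → ⨁ f ≡ true
countTrue≡1⇒⨁ f c with countTrue≡1⇒singleton f c
... | a , fa , off = trans (⨁-concentrated f a off) fa

Unique-lookup-injective : ∀ {a} {A : Set a} {xs : List A} → Unique xs →
  ∀ i j → lookup xs i ≡ lookup xs j → i ≡ j
Unique-lookup-injective (x∉ ∷ u) zero    zero    _  = refl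
Unique-lookup-injective (x∉ ∷ u) zero    (suc j) eq = contradiction eq (All.lookup x∉ (∈-lookup j))
Unique-lookup-injective (x∉ ∷ u) (suc i) zero    eq = contradiction (sym eq) (All.lookup x∉ (∈-lookup i))
Unique-lookup-injective (x∉ ∷ u) (suc i) (suc j) eq = cong suc (Unique-lookup-injective u i j eq)

Unique⇒length≤ : ∀ {k} {xs : List (Fin k)} → Unique xs → length xs ≤ k
Unique⇒length≤ {k} {xs} u with length xs ≤? k
... | yes ≤k = ≤k
... | no  ≰k with pigeonhole (≰⇒> ≰k) (lookup xs)
...   | i , j , i<j , eq = contradiction (Unique-lookup-injective u i j eq) λ { refl → <-irrefl refl i<j }

Unique-map-injective : ∀ {a b} {A : Set a} {B : Set b} (τ : A → B) {as} → Unique (map τ as) →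
  ∀ {x y} → x ∈ as → y ∈ as → τ x ≡ τ y → x ≡ y
Unique-map-injective τ u         (here refl) (here refl) _  = refl
Unique-map-injective τ (τx∉ ∷ u) (here refl) (there y∈)  eq = contradiction eq (All.lookup τx∉ (∈-map⁺ τ y∈))
Unique-map-injective τ (τy∉ ∷ u) (there x∈)  (here refl) eq =
  contradiction (sym eq) (All.lookup τy∉ (∈-map⁺ τ x∈))
Unique-map-injective τ (_ ∷ u)   (there x∈)  (there y∈)  eq = Unique-map-injective τ u x∈ y∈ eq

Unique-++⁻ : ∀ {a} {A : Set a} (xs : List A) {ys} → Unique (xs ++ ys) →
  Unique xs × Unique ys × Disjoint xs ys
Unique-++⁻ []       u          = [] , u , λ ()
Unique-++⁻ (x ∷ xs) (x∉ ∷ u) with Unique-++⁻ xs u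
... | uxs , uys , disjoint =
  ++⁻ˡ xs x∉ ∷ uxs , uys ,
  λ { (here refl , x∈ys) → All.lookup (++⁻ʳ xs x∉) x∈ys refl
    ; (there v∈xs , v∈ys) → disjoint (v∈xs , v∈ys) }

Unique-∷ʳ : ∀ {a} {A : Set a} {x : A} {xs} → Unique (x ∷ xs) → Unique (xs ∷ʳ x)
Unique-∷ʳ (x∉ ∷ u) = Unique.++⁺ u ([] ∷ []) λ { (v∈xs , here refl) → All.lookup x∉ v∈xs refl }

countTrue-fibre : ∀ {k l} (τ : Fin k → Fin l) {as} → Unique (map τ as) → ∀ {v} → v ∈ map τ as →
  countTrue (λ f → ⌊ f ∈? as ⌋ ∧ ⌊ τ f ≟ v ⌋) ≡ 1
countTrue-fibre τ {as} u {v} v∈ with ∈-map⁻ τ v∈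
... | a , a∈ , refl = countTrue-singleton _ a
  (cong₂ _∧_ (⌊yes⌋ (a ∈? as) a∈) (⌊yes⌋ (τ a ≟ τ a) refl))
  λ f t → let (f∈ , τf≡) = ∧-true⁻ ⌊ f ∈? as ⌋ t in
          Unique-map-injective τ u (⌊⌋-witness (f ∈? as) f∈) a∈ (⌊⌋-witness (τ f ≟ τ a) τf≡)

⨁-∈ : ∀ {k} (g : Fin k → Bool) {as} → Unique as →
  ⨁ (λ f → ⌊ f ∈? as ⌋ ∧ g f) ≡ foldr (λ c acc → g c xor acc) false as
⨁-∈ g [] = ⨁-zero (λ f → ⌊ f ∈? [] ⌋ ∧ g f) λ _ → refl
⨁-∈ g {a ∷ as} (a∉ ∷ u) = begin
  ⨁ (λ f → ⌊ f ∈? (a ∷ as) ⌋ ∧ g f)                     ≡⟨ ⊕.sum-cong-≗ split ⟩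
  ⨁ (λ f → (⌊ f ≟ a ⌋ ∧ g f) xor (⌊ f ∈? as ⌋ ∧ g f))
    ≡⟨ ⊕.∑-distrib-+ (λ f → ⌊ f ≟ a ⌋ ∧ g f) (λ f → ⌊ f ∈? as ⌋ ∧ g f) ⟩
  ⨁ (λ f → ⌊ f ≟ a ⌋ ∧ g f) xor ⨁ (λ f → ⌊ f ∈? as ⌋ ∧ g f)
    ≡⟨ cong₂ _xor_ (⨁-concentrated (λ f → ⌊ f ≟ a ⌋ ∧ g f) a
                      (λ f t → ⌊⌋-witness (f ≟ a) (proj₁ (∧-true⁻ ⌊ f ≟ a ⌋ t))))
                   (⨁-∈ g u) ⟩
  (⌊ a ≟ a ⌋ ∧ g a) xor foldr (λ c acc → g c xor acc) false as
    ≡⟨ cong (λ b → (b ∧ g a) xor foldr (λ c acc → g c xor acc) false as) (⌊yes⌋ (a ≟ a) refl) ⟩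
  g a xor foldr (λ c acc → g c xor acc) false as ∎
  where
  open ≡-Reasoning
  split : ∀ f → ⌊ f ∈? (a ∷ as) ⌋ ∧ g f ≡ (⌊ f ≟ a ⌋ ∧ g f) xor (⌊ f ∈? as ⌋ ∧ g f)
  split f with f ≟ a | f ∈? as
  ... | yes refl | yes a∈ = contradiction a∈ (All¬⇒¬Any a∉)
  ... | yes refl | no  _  = sym (xor-identityʳ (g f))
  ... | no  _    | yes _  = refl
  ... | no  _    | no  _  = refl

xor≡false⇒≡ : ∀ x y → x xor y ≡ false → x ≡ y
xor≡false⇒≡ false false _ = refl
xor≡false⇒≡ true  true  _ = refl

xor-cancelˡ : ∀ x y → x xor (x xor y) ≡ y
xor-cancelˡ false y = refl
xor-cancelˡ true  y = not-involutive y

isNegative : Sign → Bool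
isNegative plus  = false
isNegative minus = true

isNegative-· : ∀ s t → isNegative (s · t) ≡ isNegative s xor isNegative t
isNegative-· plus  t     = refl
isNegative-· minus plus  = refl
isNegative-· minus minus = refl

isNegative≡false⇒plus : ∀ {s} → isNegative s ≡ false → s ≡ plus
isNegative≡false⇒plus {plus} _ = refl

arc-balanced⇔xor : ∀ s {x y} → ((s ≡ plus → x ≡ y) × (s ≡ minus → x ≢ y)) ⇔ (x xor y ≡ isNegative s)
arc-balanced⇔xor plus {x} {y} =
  mk⇔ (λ (x≡y , _) → trans (cong (_xor y) (x≡y refl)) (xor-same y))
      (λ x⊕y≡false → (λ _ → xor≡false⇒≡ x y x⊕y≡false) , λ ())
arc-balanced⇔xor minus {x} {y} =
  mk⇔ (λ (_ , x≢y) → trans (cong (_xor y) (¬-not (x≢y refl))) (xor-inverseˡ y))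
      (λ x⊕y≡true → (λ ()) , λ _ x≡y →
         contradiction (trans (sym (xor-same x)) (trans (cong (x xor_) x≡y) x⊕y≡true)) λ ())

module _ (D : SignedDigraph) where
  open SignedDigraph D

  count≡countTrue : (f : Fin m → Bool) → count D f ≡ countTrue f
  count≡countTrue f = go id
    where
    go : ∀ {k} (h : Fin k → Fin m) → sum (map (λ e → if f e then 1 else 0) (tabulate h)) ≡ countTrue (f ∘ h)
    go {zero}  h = refl
    go {suc k} h = cong ((if f (h zero) then 1 else 0) +_) (go (h ∘ suc))

  isNegative-sgn : (S : ArcSet D) → isNegative (sgn D S) ≡ ⨁ (λ e → S e ∧ isNegative (sign e))
  isNegative-sgn S = go id
    where
    go : ∀ {k} (h : Fin k → Fin m) →
      isNegative (foldr (λ e acc → if S e then sign e · acc else acc) plus (tabulate h)) ≡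
      ⨁ (λ i → S (h i) ∧ isNegative (sign (h i)))
    go {zero}  h = refl
    go {suc k} h with S (h zero)
    ... | true  = trans (isNegative-· (sign (h zero)) _) (cong (isNegative (sign (h zero)) xor_) (go (h ∘ suc)))
    ... | false = go (h ∘ suc)

  arcs : ∀ {u v} → Reach D u v → List (Fin m)
  arcs here       = []
  arcs (step e p) = e ∷ arcs p

  vertices : ∀ {u v} → Reach D u v → List (Fin n)
  vertices {u} here = u ∷ []
  vertices (step e p) = tail e ∷ vertices p

  negative : ∀ {u v} → Reach D u v → Bool
  negative p = foldr (λ e b → isNegative (sign e) xor b) false (arcs p)

  _++ʷ_ : ∀ {u v w} → Reach D u v → Reach D v w → Reach D u w
  here     ++ʷ q = q
  step e p ++ʷ q = step e (p ++ʷ q)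

  negative-++ʷ : ∀ {u v w} (p : Reach D u v) (q : Reach D v w) →
    negative (p ++ʷ q) ≡ negative p xor negative q
  negative-++ʷ here       q = refl
  negative-++ʷ (step e p) q =
    trans (cong (isNegative (sign e) xor_) (negative-++ʷ p q))
          (sym (xor-assoc (isNegative (sign e)) (negative p) (negative q)))

  vertices-++ʷ : ∀ {u v w} (p : Reach D u v) (q : Reach D v w) →
    vertices (p ++ʷ q) ≡ map tail (arcs p) ++ vertices q
  vertices-++ʷ here       q = refl
  vertices-++ʷ (step e p) q = cong (tail e ∷_) (vertices-++ʷ p q)

  length-vertices : ∀ {u v} (p : Reach D u v) → length (vertices p) ≡ suc (length (arcs p))
  length-vertices here       = refl
  length-vertices (step e p) = cong suc (length-vertices p)

  start∈vertices : ∀ {u v} (p : Reach D u v) → u ∈ vertices p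
  start∈vertices here       = here refl
  start∈vertices (step e p) = here refl

  end∈vertices : ∀ {u v} (p : Reach D u v) → v ∈ vertices p
  end∈vertices here       = here refl
  end∈vertices (step e p) = there (end∈vertices p)

  start∷heads≡tails∷ʳend : ∀ {u v} (p : Reach D u v) → u ∷ map head (arcs p) ≡ map tail (arcs p) ∷ʳ v
  start∷heads≡tails∷ʳend here       = refl
  start∷heads≡tails∷ʳend (step e p) = cong (tail e ∷_) (start∷heads≡tails∷ʳend p)

  split : ∀ {u v t} (p : Reach D u v) → t ∈ vertices p →
    Σ (Reach D u t) λ p₁ → Σ (Reach D t v) λ p₂ → p ≡ p₁ ++ʷ p₂
  split here       (here refl) = here , here , refl
  split (step e p) (here refl) = here , step e p , refl
  split (step e p) (there t∈)  with split p t∈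
  ... | p₁ , p₂ , refl = step e p₁ , p₂ , refl

  UConn-trans : ∀ {S u v w} → UConn D S u v → UConn D S v w → UConn D S u w
  UConn-trans here        q = q
  UConn-trans (fwd e s p) q = fwd e s (UConn-trans p q)
  UConn-trans (bwd e s p) q = bwd e s (UConn-trans p q)

  walk⇒UConn : ∀ {S u v} (p : Reach D u v) → (∀ {f} → f ∈ arcs p → S f ≡ true) → UConn D S u v
  walk⇒UConn here       _   = here
  walk⇒UConn (step e p) p⊆S = fwd e (p⊆S (here refl)) (walk⇒UConn p (p⊆S ∘ there))

  source⇒UConn : ∀ {S u v w} (p : Reach D u v) → (∀ {f} → f ∈ arcs p → S f ≡ true) →
    w ∈ map tail (arcs p) → UConn D S u w × UConn D S w v
  source⇒UConn (step e p) p⊆S (here refl) = here , walk⇒UConn (step e p) p⊆S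
  source⇒UConn (step e p) p⊆S (there w∈)  =
    let (u→w , w→v) = source⇒UConn p (p⊆S ∘ there) w∈ in fwd e (p⊆S (here refl)) u→w , w→v

  arcSet : List (Fin m) → ArcSet D
  arcSet as f = ⌊ f ∈? as ⌋

  simpleClosedWalk⇒cycle : ∀ e (p : Reach D (head e) (tail e)) →
    Unique (map tail (arcs (step e p))) →
    IsCycle D (arcSet (arcs (step e p))) ×
    isNegative (sgn D (arcSet (arcs (step e p)))) ≡ negative (step e p)
  simpleClosedWalk⇒cycle e p uT = ((e , ⌊yes⌋ (e ∈? as) (here refl)) , degrees , connected) , sign-eq
    where
    C : Reach D (tail e) (tail e)
    C = step e p
    as : List (Fin m)
    as = arcs C
    S : ArcSet D
    S = arcSet as
    heads≡ : map head as ≡ map tail (arcs p) ∷ʳ tail e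
    heads≡ = start∷heads≡tails∷ʳend p
    head∈⇒tail∈ : ∀ {v} → v ∈ map head as → v ∈ map tail as
    head∈⇒tail∈ v∈ with ∈-++⁻ (map tail (arcs p)) (subst (_ ∈_) heads≡ v∈)
    ... | inj₁ v∈tails     = there v∈tails
    ... | inj₂ (here refl) = here refl
    tail∈⇒head∈ : ∀ {v} → v ∈ map tail as → v ∈ map head as
    tail∈⇒head∈ (here refl) = subst (_ ∈_) (sym heads≡) (∈-++⁺ʳ (map tail (arcs p)) (here refl))
    tail∈⇒head∈ (there v∈)  = subst (_ ∈_) (sym heads≡) (∈-++⁺ˡ v∈)
    InSub⇒tail∈ : ∀ {v} → InSub D S v → v ∈ map tail as
    InSub⇒tail∈ (f , Sf , inj₁ refl) = ∈-map⁺ tail (⌊⌋-witness (f ∈? as) Sf)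
    InSub⇒tail∈ (f , Sf , inj₂ refl) = head∈⇒tail∈ (∈-map⁺ head (⌊⌋-witness (f ∈? as) Sf))
    degrees : ∀ v → InSub D S v → indeg D S v ≡ 1 × outdeg D S v ≡ 1
    degrees v iv =
      trans (count≡countTrue _) (countTrue-fibre head uH (tail∈⇒head∈ (InSub⇒tail∈ iv))) ,
      trans (count≡countTrue _) (countTrue-fibre tail uT (InSub⇒tail∈ iv))
      where
      uH : Unique (map head as)
      uH = subst Unique (sym heads≡) (Unique-∷ʳ uT)
    C⊆S : ∀ {f} → f ∈ as → S f ≡ true
    C⊆S {f} = ⌊yes⌋ (f ∈? as)
    connected : ∀ u v → InSub D S u → InSub D S v → UConn D S u v
    connected u v iu iv =
      UConn-trans (proj₂ (source⇒UConn C C⊆S (InSub⇒tail∈ iu)))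
                  (proj₁ (source⇒UConn C C⊆S (InSub⇒tail∈ iv)))
    sign-eq : isNegative (sgn D S) ≡ negative C
    sign-eq = trans (isNegative-sgn S) (⨁-∈ (isNegative ∘ sign) (Unique.map⁻ uT))

  BoundedWalk : ℕ → Fin n → Fin n → Bool → Set
  BoundedWalk k u v b = Σ (Reach D u v) λ q → length (arcs q) ≤ k × negative q ≡ b

  boundedWalk? : ∀ k u v b → Dec (BoundedWalk k u v b)
  boundedWalk? zero u v b with u ≟ v | b Bool.≟ false
  ... | yes refl | yes refl = yes (here , z≤n , refl)
  ... | no  u≢v  | _        = no λ { (here , _ , _) → u≢v refl ; (step _ _ , () , _) }
  ... | yes refl | no  b≢f  = no λ { (here , _ , f≡b) → b≢f (sym f≡b) ; (step _ _ , () , _) }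
  boundedWalk? (suc k) u v b
    with (u ≟ v) ×-dec (b Bool.≟ false)
       | any? (λ e → (tail e ≟ u) ×-dec boundedWalk? k (head e) v (isNegative (sign e) xor b))
  ... | yes (refl , refl) | _ = yes (here , z≤n , refl)
  ... | no _ | yes (e , refl , q , l , q≡) =
    yes (step e q , s≤s l , trans (cong (isNegative (sign e) xor_) q≡) (xor-cancelˡ (isNegative (sign e)) b))
  ... | no ¬here | no ¬step = no λ
    { (here , _ , f≡b) → ¬here (refl , sym f≡b)
    ; (step e q , s≤s l , eq) → ¬step (e , refl , q , l ,
        trans (sym (xor-cancelˡ (isNegative (sign e)) (negative q))) (cong (isNegative (sign e) xor_) eq)) }

  module _ (balanced : CycleBalanced D) where

    simpleClosedWalk-nonnegative : ∀ e (p : Reach D (head e) (tail e)) →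
      Unique (map tail (arcs (step e p))) → negative (step e p) ≡ false
    simpleClosedWalk-nonnegative e p u =
      let (isCycle , sgn≡negative) = simpleClosedWalk⇒cycle e p u in
      trans (sym sgn≡negative) (cong isNegative (balanced _ isCycle))

    simplify : ∀ {u v} (p : Reach D u v) → Σ (Reach D u v) λ q → Unique (vertices q) × negative q ≡ negative p
    simplify here = here , [] ∷ [] , refl
    simplify (step e p) with simplify p
    ... | q , uq , q≡p with tail e ∈? vertices q
    ...   | no  te∉ = step e q , ¬Any⇒All¬ (vertices q) te∉ ∷ uq , cong (isNegative (sign e) xor_) q≡p
    ...   | yes te∈ with split q te∈
    ...     | q₁ , q₂ , refl with Unique-++⁻ (map tail (arcs q₁)) (subst Unique (vertices-++ʷ q₁ q₂) uq)
    ...       | uq₁ , uq₂ , disjoint = q₂ , uq₂ , parity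
      where
      s : Bool
      s = isNegative (sign e)
      cycle-nonnegative : negative (step e q₁) ≡ false
      cycle-nonnegative = simpleClosedWalk-nonnegative e q₁
        (¬Any⇒All¬ _ (λ te∈q₁ → disjoint (te∈q₁ , start∈vertices q₂)) ∷ uq₁)
      parity : negative q₂ ≡ s xor negative p
      parity = begin
        negative q₂                                ≡⟨ cong (_xor negative q₂) cycle-nonnegative ⟨
        (s xor negative q₁) xor negative q₂        ≡⟨ xor-assoc s (negative q₁) (negative q₂) ⟩
        s xor (negative q₁ xor negative q₂)        ≡⟨ cong (s xor_) (negative-++ʷ q₁ q₂) ⟨
        s xor negative (q₁ ++ʷ q₂)                 ≡⟨ cong (s xor_) q≡p ⟩
        s xor negative p                           ∎
        where open ≡-Reasoning

    closedWalk-nonnegative : ∀ {u} (p : Reach D u u) → negative p ≡ false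
    closedWalk-nonnegative p with simplify p
    ... | here     , _       , p≡ = sym p≡
    ... | step e q , te∉ ∷ _ , _  = contradiction (end∈vertices q) (All¬⇒¬Any te∉)

    shorten : ∀ {u v} (p : Reach D u v) → BoundedWalk n u v (negative p)
    shorten p with simplify p
    ... | q , uq , q≡p = q , <⇒≤ (subst (_≤ n) (length-vertices q) (Unique⇒length≤ uq)) , q≡p

    returning-walks-same-parity : ∀ {r x} (p q : Reach D r x) → Reach D x r → negative p ≡ negative q
    returning-walks-same-parity p q back =
      trans (closes p) (sym (closes q))
      where
      closes : ∀ p → negative p ≡ negative back
      closes p = xor≡false⇒≡ (negative p) (negative back)
        (trans (sym (negative-++ʷ p back)) (closedWalk-nonnegative (p ++ʷ back)))

    negativeSide : Fin n → Fin n → Bool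
    negativeSide r v = ⌊ boundedWalk? n r v true ⌋

    negativeSide-correct : ∀ {r x} (q : Reach D r x) → Reach D x r → negativeSide r x ≡ negative q
    negativeSide-correct {r} {x} q back with boundedWalk? n r x true
    ... | yes (q′ , _ , q′≡true) = trans (sym q′≡true) (returning-walks-same-parity q′ q back)
    ... | no ¬short with negative q in q≡
    ...   | false = refl
    ...   | true  = contradiction (subst (BoundedWalk n r x) q≡ (shorten q)) ¬short

    cycle-balanced⇒component-balanced : ∀ r → ComponentBalanced D r
    cycle-balanced⇒component-balanced r = negativeSide r , λ e (r→t , t→r) (_ , h→r) →
      Equivalence.from (arc-balanced⇔xor (sign e)) (begin
        negativeSide r (tail e) xor negativeSide r (head e)
          ≡⟨ cong₂ _xor_ (negativeSide-correct r→t t→r) (negativeSide-correct (r→t ++ʷ step e here) h→r) ⟩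
        negative r→t xor negative (r→t ++ʷ step e here)
          ≡⟨ cong (negative r→t xor_) (negative-++ʷ r→t (step e here)) ⟩
        negative r→t xor (negative r→t xor (isNegative (sign e) xor false))
          ≡⟨ xor-cancelˡ (negative r→t) _ ⟩
        isNegative (sign e) xor false
          ≡⟨ xor-identityʳ _ ⟩
        isNegative (sign e) ∎)
      where open ≡-Reasoning

  SameComp-trans : ∀ {x y z} → SameComp D x y → SameComp D y z → SameComp D x z
  SameComp-trans (x→y , y→x) (y→z , z→y) = x→y ++ʷ y→z , z→y ++ʷ y→x

  degreeParity : ArcSet D → (Fin m → Fin n) → Fin n → Bool
  degreeParity S τ v = ⨁ (λ f → S f ∧ ⌊ τ f ≟ v ⌋)

  -- Summing x (tail f) xor x (head f) over the arcs of S counts every vertex v with multiplicity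
  -- outdeg v + indeg v, which is even.
  eulerian-nonnegative : (S : ArcSet D) (x : Fin n → Bool) →
    (∀ v → degreeParity S tail v ≡ degreeParity S head v) →
    (∀ f → S f ≡ true → x (tail f) xor x (head f) ≡ isNegative (sign f)) →
    isNegative (sgn D S) ≡ false
  eulerian-nonnegative S x out≡in switching = begin
    isNegative (sgn D S)                                      ≡⟨ isNegative-sgn S ⟩
    ⨁ (λ f → S f ∧ isNegative (sign f))                       ≡⟨ ⊕.sum-cong-≗ arc ⟩
    ⨁ (λ f → S f ∧ (x (tail f) xor x (head f)))
      ≡⟨ ⊕.sum-cong-≗ (λ f → ∧-distribˡ-xor (S f) (x (tail f)) (x (head f))) ⟩
    ⨁ (λ f → (S f ∧ x (tail f)) xor (S f ∧ x (head f)))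
      ≡⟨ ⊕.∑-distrib-+ (λ f → S f ∧ x (tail f)) (λ f → S f ∧ x (head f)) ⟩
    ⨁ (λ f → S f ∧ x (tail f)) xor ⨁ (λ f → S f ∧ x (head f))
      ≡⟨ cong₂ _xor_ (⨁-fibres tail S x) (⨁-fibres head S x) ⟩
    ⨁ (λ v → degreeParity S tail v ∧ x v) xor ⨁ (λ v → degreeParity S head v ∧ x v)
      ≡⟨ cong (_xor ⨁ (λ v → degreeParity S head v ∧ x v)) (⊕.sum-cong-≗ λ v → cong (_∧ x v) (out≡in v)) ⟩
    ⨁ (λ v → degreeParity S head v ∧ x v) xor ⨁ (λ v → degreeParity S head v ∧ x v)
      ≡⟨ xor-same (⨁ (λ v → degreeParity S head v ∧ x v)) ⟩
    false ∎
    where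
    open ≡-Reasoning
    arc : ∀ f → S f ∧ isNegative (sign f) ≡ S f ∧ (x (tail f) xor x (head f))
    arc f with S f in Sf
    ... | true  = sym (switching f Sf)
    ... | false = refl

  module CycleWalk (S : ArcSet D) (deg : ∀ v → InSub D S v → indeg D S v ≡ 1 × outdeg D S v ≡ 1) where

    record UniqueArc (τ : Fin m → Fin n) (v : Fin n) : Set where
      field
        arc    : Fin m
        arc∈S  : S arc ≡ true
        τ-arc  : τ arc ≡ v
        unique : ∀ g → S g ≡ true → τ g ≡ v → g ≡ arc
    open UniqueArc

    uniqueArc : (τ : Fin m → Fin n) → ∀ {v} → count D (λ f → S f ∧ ⌊ τ f ≟ v ⌋) ≡ 1 → UniqueArc τ v
    uniqueArc τ {v} c with countTrue≡1⇒singleton _ (trans (sym (count≡countTrue _)) c)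
    ... | f , t , off = record
      { arc    = f
      ; arc∈S  = proj₁ (∧-true⁻ (S f) t)
      ; τ-arc  = ⌊⌋-witness (τ f ≟ v) (proj₂ (∧-true⁻ (S f) t))
      ; unique = λ g Sg τg≡v → off g (cong₂ _∧_ Sg (⌊yes⌋ (τ g ≟ v) τg≡v))
      }

    V : Set
    V = Σ (Fin n) (InSub D S)

    outArc : (x : V) → UniqueArc tail (proj₁ x)
    outArc (v , iv) = uniqueArc tail (proj₂ (deg v iv))

    inArc : (x : V) → UniqueArc head (proj₁ x)
    inArc (v , iv) = uniqueArc head (proj₁ (deg v iv))

    next : V → V
    next x = head (arc (outArc x)) , arc (outArc x) , arc∈S (outArc x) , inj₂ refl

    next-reach : ∀ x → Reach D (proj₁ x) (proj₁ (next x))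
    next-reach x = subst (λ t → Reach D t (proj₁ (next x))) (τ-arc (outArc x)) (step (arc (outArc x)) here)

    next-injective : ∀ x y → proj₁ (next x) ≡ proj₁ (next y) → proj₁ x ≡ proj₁ y
    next-injective x y heads≡ = begin
      proj₁ x ≡⟨ τ-arc (outArc x) ⟨
      tail f  ≡⟨ cong tail (trans (unique into f (arc∈S (outArc x)) heads≡)
                                  (sym (unique into g (arc∈S (outArc y)) refl))) ⟩
      tail g  ≡⟨ τ-arc (outArc y) ⟩
      proj₁ y ∎
      where
      open ≡-Reasoning
      f g : Fin m
      f = arc (outArc x)
      g = arc (outArc y)
      into : UniqueArc head (proj₁ (next y))
      into = inArc (next y)

    next^ : ℕ → V → V
    next^ zero    x = x
    next^ (suc k) x = next (next^ k x)

    next^-suc : ∀ k x → next^ (suc k) x ≡ next^ k (next x)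
    next^-suc zero    x = refl
    next^-suc (suc k) x = cong next (next^-suc k x)

    next^-reach : ∀ x k → Reach D (proj₁ x) (proj₁ (next^ k x))
    next^-reach x zero    = here
    next^-reach x (suc k) = next^-reach x k ++ʷ next-reach (next^ k x)

    next^-cancel : ∀ i d x → proj₁ (next^ i x) ≡ proj₁ (next^ (i + d) x) → proj₁ x ≡ proj₁ (next^ d x)
    next^-cancel zero    d x eq = eq
    next^-cancel (suc i) d x eq = next^-cancel i d x (next-injective _ _ eq)

    -- Following out-arcs from x must revisit a vertex (pigeonhole), and by injectivity of next the first
    -- vertex revisited is x itself.
    next-returns : ∀ x → Reach D (proj₁ (next x)) (proj₁ x)
    next-returns x with pigeonhole ≤-refl (λ (i : Fin (suc n)) → proj₁ (next^ (toℕ i) x))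
    ... | i , j , i<j , eq with m≤n⇒∃[o]m+o≡n i<j
    ...   | d , i+d≡j = subst (Reach D _) (sym returns) (next^-reach (next x) d)
      where
      returns : proj₁ x ≡ proj₁ (next^ d (next x))
      j≡i+suc-d : toℕ j ≡ toℕ i + suc d
      j≡i+suc-d = trans (sym i+d≡j) (sym (+-suc (toℕ i) d))
      returns = trans (next^-cancel (toℕ i) (suc d) x (trans eq (cong (λ k → proj₁ (next^ k x)) j≡i+suc-d)))
                      (cong proj₁ (next^-suc d x))

    arc-returns : ∀ {e} → S e ≡ true → Reach D (head e) (tail e)
    arc-returns {e} Se =
      subst (λ f → Reach D (head f) (tail e)) (sym (unique (outArc x) e Se refl)) (next-returns x)
      where
      x : V
      x = tail e , e , Se , inj₁ refl

    UConn⇒SameComp : ∀ {x y} → UConn D S x y → SameComp D x y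
    UConn⇒SameComp here          = here , here
    UConn⇒SameComp (fwd e Se x~) = SameComp-trans (step e here , arc-returns Se) (UConn⇒SameComp x~)
    UConn⇒SameComp (bwd e Se x~) = SameComp-trans (arc-returns Se , step e here) (UConn⇒SameComp x~)

    out≡in : ∀ v → degreeParity S tail v ≡ degreeParity S head v
    out≡in v with any? (λ f → (S f Bool.≟ true) ×-dec ((tail f ≟ v) ⊎-dec (head f ≟ v)))
    ... | yes iv = trans (degree-one tail (proj₂ (deg v iv))) (sym (degree-one head (proj₁ (deg v iv))))
      where
      degree-one : ∀ τ → count D (λ f → S f ∧ ⌊ τ f ≟ v ⌋) ≡ 1 → degreeParity S τ v ≡ true
      degree-one τ c = countTrue≡1⇒⨁ (λ f → S f ∧ ⌊ τ f ≟ v ⌋) (trans (sym (count≡countTrue _)) c)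
    ... | no ¬iv = trans (⨁-zero _ (absent tail inj₁)) (sym (⨁-zero _ (absent head inj₂)))
      where
      absent : ∀ τ → (∀ {f} → τ f ≡ v → tail f ≡ v ⊎ head f ≡ v) → ∀ f → S f ∧ ⌊ τ f ≟ v ⌋ ≡ false
      absent τ incident f = ¬-not λ t →
        ¬iv (f , proj₁ (∧-true⁻ (S f) t) , incident (⌊⌋-witness (τ f ≟ v) (proj₂ (∧-true⁻ (S f) t))))

  component-balanced⇒cycle-balanced : (∀ r → ComponentBalanced D r) → CycleBalanced D
  component-balanced⇒cycle-balanced balanced S ((e₀ , Se₀) , deg , connected) =
    isNegative≡false⇒plus (eulerian-nonnegative S x out≡in switching)
    where
    open CycleWalk S deg
    r : Fin n
    r = tail e₀
    r~tail : ∀ {f} → S f ≡ true → SameComp D r (tail f)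
    r~tail {f} Sf = UConn⇒SameComp (connected r (tail f) (e₀ , Se₀ , inj₁ refl) (f , Sf , inj₁ refl))
    x : Fin n → Bool
    x = proj₁ (balanced r)
    switching : ∀ f → S f ≡ true → x (tail f) xor x (head f) ≡ isNegative (sign f)
    switching f Sf = Equivalence.to (arc-balanced⇔xor (sign f))
      (proj₂ (balanced r) f (r~tail Sf) (SameComp-trans (r~tail Sf) (step f here , arc-returns Sf)))

mainTheorem9 : (D : SignedDigraph) →
    CycleBalanced D ⇔ (∀ r → ComponentBalanced D r)
mainTheorem9 D = mk⇔ (cycle-balanced⇒component-balanced D) (component-balanced⇒cycle-balanced D)
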